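{- Let $\mu\le\nu<1/1000$. Every $(\mu,\nu)$-robustly $2$-matchable graph $H$ contains a perfect $2$-matching.
   Context: A graph $H$ on $n$ vertices is $(\mu,\nu)$-robustly $2$-matchable if one of the following holds. (Type 1) $\delta(H)\ge(1/2-\mu)n$ and every set of $(1/2-\nu)n$ vertices spans at least $\nu n^2$ edges. (Type 2) $H$ is a balanced bipartite graph with parts $A,B$ of size $n/2$ such that $\delta(H)\ge(1/32-\mu)n$ and all but at most $(1/64+\mu)n$ vertices of $H$ have degree at least $(1/3-\mu)n$. A perfect $2$-matching of $H$ is a function $\omega:E(H)\to\mathbb{Z}_{\ge0}$ such that $\sum_{w\in N(v)}\omega(vw)=2$ for every vertex $v$. -}

module Defs where

open import Data.Bool using (Bool; true; false; _∧_)
open import Data.Nat as ℕ using (ℕ; zero; suc)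
open import Data.Fin using (Fin; _<_)
open import Data.Fin.Subset using (Subset; _∈_; _∉_; ∣_∣)
open import Data.List using (List; map; filter; length; allFin)
open import Data.Nat.ListAction using (sum)
open import Data.Vec using (tabulate)
open import Data.Integer using (+_)
open import Data.Rational using (ℚ; _/_; _≤_; _<_; _-_; _+_; _*_)
open import Data.Product using (Σ; _×_; _,_)
open import Relation.Binary.PropositionalEquality using (_≡_)
open import Relation.Nullary using (¬_)

record Graph (n : ℕ) : Set where
  field
    adj   : Fin n → Fin n → Bool
    sym   : ∀ u v → adj u v ≡ adj v u
    irrfl : ∀ v → adj v v ≡ false
open Graph public

ℕ→ℚ : ℕ → ℚ
ℕ→ℚ k = + k / 1

deg : ∀ {n} → Graph n → Fin n → ℕ
deg H u = ∣ tabulate (adj H u) ∣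

MinDegAtLeast : ∀ {n} → Graph n → ℚ → Set
MinDegAtLeast H d = ∀ u → d ≤ ℕ→ℚ (deg H u)

infix 4 _∈ᵇ_
_∈ᵇ_ : ∀ {n} → Fin n → Subset n → Bool
v ∈ᵇ S = Data.Vec.lookup S v

edgesIn : ∀ {n} → Graph n → Subset n → ℕ
edgesIn {n} H S =
  sum (map (λ u → sum (map (λ v → count u v) (allFin n))) (allFin n))
  where
  open import Relation.Nullary.Decidable using (⌊_⌋)
  open import Data.Fin.Properties using (_<?_)
  count : Fin n → Fin n → ℕ
  count u v with ⌊ u <? v ⌋ ∧ (u ∈ᵇ S) ∧ (v ∈ᵇ S) ∧ adj H u v
  ... | true  = 1
  ... | false = 0

RobustType1 : ∀ {n} → ℚ → ℚ → Graph n → Set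
RobustType1 {n} μ ν H =
  MinDegAtLeast H ((+ 1 / 2 - μ) * ℕ→ℚ n)
  × (∀ (S : Subset n) → (+ 1 / 2 - ν) * ℕ→ℚ n ≤ ℕ→ℚ ∣ S ∣ →
       ν * ℕ→ℚ (n ℕ.* n) ≤ ℕ→ℚ (edgesIn H S))

BipartiteWith : ∀ {n} → Graph n → Subset n → Set
BipartiteWith H A = ∀ u v → adj H u v ≡ true → ¬ ((u ∈ᵇ A) ≡ (v ∈ᵇ A))

numLowDeg : ∀ {n} → Graph n → ℚ → ℕ
numLowDeg {n} H d = length (filter (λ u → Data.Rational._<?_ (ℕ→ℚ (deg H u)) d) (allFin n))

RobustType2 : ∀ {n} → ℚ → ℚ → Graph n → Set
RobustType2 {n} μ ν H =
  Σ (Subset n) λ A → (2 ℕ.* ∣ A ∣ ≡ n) × BipartiteWith H A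
  × MinDegAtLeast H ((+ 1 / 32 - μ) * ℕ→ℚ n)
  × ℕ→ℚ (numLowDeg H ((+ 1 / 3 - μ) * ℕ→ℚ n)) ≤ (+ 1 / 64 + μ) * ℕ→ℚ n

RobustlyTwoMatchable : ∀ {n} → ℚ → ℚ → Graph n → Set
RobustlyTwoMatchable μ ν H = RobustType1 μ ν H Data.Sum.⊎ RobustType2 μ ν H
  where import Data.Sum

-- A perfect 2-matching: ω : E(H) → ℕ, represented as a symmetric function
-- on ordered pairs vanishing on non-edges, such that for every vertex v,
-- Σ_{w ∈ N(v)} ω(vw) = 2.
record PerfectTwoMatching {n} (H : Graph n) : Set where
  field
    ω        : Fin n → Fin n → ℕ
    ω-sym    : ∀ u v → ω u v ≡ ω v u
    ω-edges  : ∀ u v → adj H u v ≡ false → ω u v ≡ 0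
    ω-deg    : ∀ v → sum (map (ω v) (allFin n)) ≡ 2

module Submission where

-- A perfect matching of the bipartite double cover of H is a permutation π of the vertices with
-- π u adjacent to u for every u, and ω(uv) = [π u = v] + [π v = u] is then a perfect 2-matching.
-- By Hall's theorem, proved here by Rado's edge-deletion argument, such a π exists as soon as
-- ∣ X ∣ ≤ ∣ N(X) ∣ for every vertex set X.
--
-- Type 1: X ∖ N(X) is independent, so by the density condition it has fewer than
-- (1/2 - ν) n ≤ δ(H) vertices; hence it has at least as many neighbours as elements, and these
-- lie in N(X) ∖ X.
--
-- Type 2: it suffices to consider X inside one side S. Suppose ∣ N(X) ∣ < ∣ X ∣ and let W be the
-- set of vertices of the other side outside N(X). Then ∣ W ∣ > ∣ S ∖ X ∣ and all neighbours of W
-- lie in S ∖ X, while all neighbours of X lie in N(X). A nonempty set U whose vertices all have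
-- degree below ∣ U ∣ contains a vertex of degree at least 0.33 n, because there are at most n/50
-- vertices of lower degree and each has degree at least n/40. Applied to W this gives
-- ∣ S ∖ X ∣ ≥ 0.33 n, so ∣ X ∣ ≤ 0.17 n; applied to X it gives a vertex whose degree is at least
-- 0.33 n and below ∣ X ∣.

open import Defs hiding (sym)

open import Data.Bool using (true; false; _∧_; if_then_else_)
open import Data.Bool.Properties using (∧-zeroʳ; ¬-not)
open import Data.Nat as ℕ using (ℕ; zero; suc; z≤n; s≤s; _+_; _*_; _∸_; _≤_; _<_)
import Data.Nat.Properties as ℕₚ
open import Data.Nat.Induction using (<-wellFounded)
open import Data.Nat.ListAction using (sum)
import Data.Nat.Coprimality as Coprimality
import Data.Integer as ℤ
import Data.Integer.Properties as ℤₚ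
open import Data.Rational as ℚ using (ℚ; _/_; 0ℚ; mkℚ)
import Data.Rational.Properties as ℚₚ
open import Data.Fin using (Fin; zero; suc; punchOut)
open import Data.Fin.Properties using (toℕ<n; _≟_; _<?_; any?; punchOut-injective; injective⇒≤)
open import Data.Fin.Subset
open import Data.Fin.Subset.Properties
open import Data.List as List using (map; allFin; filter; length)
open import Data.List.Properties using (map-tabulate)
open import Data.Vec using (_∷_; []; here; there; tabulate; lookup)
open import Data.Vec.Properties using (lookup∘tabulate; []=⇒lookup; lookup⇒[]=)
open import Data.Vec.Functional using (updateAt)
open import Data.Vec.Functional.Properties using (updateAt-updates; updateAt-minimal)
open import Data.Product using (Σ; ∃; _×_; _,_; proj₁; proj₂)
open import Data.Sum using (_⊎_; inj₁; inj₂)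
open import Algebra.Properties.CommutativeMonoid.Sum ℕₚ.+-0-commutativeMonoid
  using (sum-cong-≗; ∑-distrib-+; sum-replicate-zero) renaming (sum to ∑)
open import Function using (_∘_)
open import Function.Definitions using (Injective)
open import Induction.WellFounded using (Acc; acc)
open import Relation.Unary using (Pred; Decidable)
open import Relation.Nullary using (¬_; yes; no; does; contradiction)
open import Relation.Nullary.Decidable
  using (dec-true; dec-false; ⌊_⌋; decidable-stable; _×-dec_; ¬?; True; toWitness)
open import Relation.Binary.PropositionalEquality

ℕ→ℚ≡mkℚ : ∀ k → ℕ→ℚ k ≡ mkℚ (ℤ.+ k) 0 (Coprimality.sym (Coprimality.1-coprimeTo k))
ℕ→ℚ≡mkℚ k = ℚₚ.normalize-coprime (Coprimality.sym (Coprimality.1-coprimeTo k))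

ℕ→ℚ-mono-≤ : ∀ {a b} → a ≤ b → ℕ→ℚ a ℚ.≤ ℕ→ℚ b
ℕ→ℚ-mono-≤ {a} {b} a≤b rewrite ℕ→ℚ≡mkℚ a | ℕ→ℚ≡mkℚ b =
  ℚ.*≤* (ℤₚ.*-monoʳ-≤-nonNeg (ℤ.+ 1) (ℤ.+≤+ a≤b))

ℕ→ℚ-mono-< : ∀ {a b} → a < b → ℕ→ℚ a ℚ.< ℕ→ℚ b
ℕ→ℚ-mono-< {a} {b} a<b rewrite ℕ→ℚ≡mkℚ a | ℕ→ℚ≡mkℚ b =
  ℚ.*<* (subst₂ ℤ._<_ (sym (ℤₚ.*-identityʳ (ℤ.+ a))) (sym (ℤₚ.*-identityʳ (ℤ.+ b))) (ℤ.+<+ a<b))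

ℕ→ℚ-cancel-≤ : ∀ {a b} → ℕ→ℚ a ℚ.≤ ℕ→ℚ b → a ≤ b
ℕ→ℚ-cancel-≤ {a} {b} a≤b with ℚ.*≤* a*1≤b*1 ← subst₂ ℚ._≤_ (ℕ→ℚ≡mkℚ a) (ℕ→ℚ≡mkℚ b) a≤b
  with ℤ.+≤+ a≤b ← subst₂ ℤ._≤_ (ℤₚ.*-identityʳ (ℤ.+ a)) (ℤₚ.*-identityʳ (ℤ.+ b)) a*1≤b*1 = a≤b

ℕ→ℚ-cancel-< : ∀ {a b} → ℕ→ℚ a ℚ.< ℕ→ℚ b → a < b
ℕ→ℚ-cancel-< {a} {b} a<b with ℚ.*<* a*1<b*1 ← subst₂ ℚ._<_ (ℕ→ℚ≡mkℚ a) (ℕ→ℚ≡mkℚ b) a<b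
  with ℤ.+<+ a<b ← subst₂ ℤ._<_ (ℤₚ.*-identityʳ (ℤ.+ a)) (ℤₚ.*-identityʳ (ℤ.+ b)) a*1<b*1 = a<b

ℕ→ℚ-homo-* : ∀ a b → ℕ→ℚ (a * b) ≡ ℕ→ℚ a ℚ.* ℕ→ℚ b
ℕ→ℚ-homo-* a b rewrite ℕ→ℚ≡mkℚ a | ℕ→ℚ≡mkℚ b = cong (_/ 1) (ℤₚ.pos-* a b)

ℕ→ℚ-nonNeg : ∀ k → ℚ.NonNegative (ℕ→ℚ k)
ℕ→ℚ-nonNeg k = ℚ.nonNegative (ℕ→ℚ-mono-≤ {0} {k} z≤n)

*-ℕ→ℚ-pos : ∀ {q k} → 0ℚ ℚ.< q → 0 < k → 0ℚ ℚ.< q ℚ.* ℕ→ℚ k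
*-ℕ→ℚ-pos {q} {k} 0<q 0<k = begin-strict
  0ℚ            ≡⟨ ℚₚ.*-zeroʳ q ⟨
  q ℚ.* 0ℚ      <⟨ ℚₚ.*-monoʳ-<-pos q {{ℚ.positive 0<q}} (ℕ→ℚ-mono-< 0<k) ⟩
  q ℚ.* ℕ→ℚ k  ∎
  where open ℚₚ.≤-Reasoning

-- The hypothesis a = k (c ∓ e) is meant to be closed by refl: it names the rational a / k that
-- replaces c ∓ μ, so that the bound on d (or L) becomes an inequality between natural numbers.
lower-bound-ℕ : ∀ (c e μ : ℚ) (a k n d : ℕ) → μ ℚ.≤ e → ℕ→ℚ a ≡ ℕ→ℚ k ℚ.* (c ℚ.- e) →
  (c ℚ.- μ) ℚ.* ℕ→ℚ n ℚ.≤ ℕ→ℚ d → a * n ≤ k * d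
lower-bound-ℕ c e μ a k n d μ≤e a≡k[c-e] bound = ℕ→ℚ-cancel-≤ (begin
  ℕ→ℚ (a * n)               ≡⟨ ℕ→ℚ-homo-* a n ⟩
  ℕ→ℚ a ℚ.* N               ≡⟨ cong (ℚ._* N) a≡k[c-e] ⟩
  (K ℚ.* (c ℚ.- e)) ℚ.* N   ≡⟨ ℚₚ.*-assoc K (c ℚ.- e) N ⟩
  K ℚ.* ((c ℚ.- e) ℚ.* N)   ≤⟨ K*-mono (*N-mono (ℚₚ.+-monoʳ-≤ c (ℚₚ.neg-antimono-≤ μ≤e))) ⟩
  K ℚ.* ((c ℚ.- μ) ℚ.* N)   ≤⟨ K*-mono bound ⟩
  K ℚ.* ℕ→ℚ d               ≡⟨ ℕ→ℚ-homo-* k d ⟨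
  ℕ→ℚ (k * d)               ∎)
  where
  open ℚₚ.≤-Reasoning
  N = ℕ→ℚ n
  K = ℕ→ℚ k
  K*-mono : ∀ {p r} → p ℚ.≤ r → K ℚ.* p ℚ.≤ K ℚ.* r
  K*-mono = ℚₚ.*-monoˡ-≤-nonNeg K {{ℕ→ℚ-nonNeg k}}
  *N-mono : ∀ {p r} → p ℚ.≤ r → p ℚ.* N ℚ.≤ r ℚ.* N
  *N-mono = ℚₚ.*-monoʳ-≤-nonNeg N {{ℕ→ℚ-nonNeg n}}

upper-bound-ℕ : ∀ (c e μ : ℚ) (a k n L : ℕ) → μ ℚ.≤ e → ℕ→ℚ a ≡ ℕ→ℚ k ℚ.* (c ℚ.+ e) →
  ℕ→ℚ L ℚ.≤ (c ℚ.+ μ) ℚ.* ℕ→ℚ n → k * L ≤ a * n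
upper-bound-ℕ c e μ a k n L μ≤e a≡k[c+e] bound = ℕ→ℚ-cancel-≤ (begin
  ℕ→ℚ (k * L)               ≡⟨ ℕ→ℚ-homo-* k L ⟩
  K ℚ.* ℕ→ℚ L               ≤⟨ K*-mono bound ⟩
  K ℚ.* ((c ℚ.+ μ) ℚ.* N)   ≤⟨ K*-mono (*N-mono (ℚₚ.+-monoʳ-≤ c μ≤e)) ⟩
  K ℚ.* ((c ℚ.+ e) ℚ.* N)   ≡⟨ ℚₚ.*-assoc K (c ℚ.+ e) N ⟨
  (K ℚ.* (c ℚ.+ e)) ℚ.* N   ≡⟨ cong (ℚ._* N) a≡k[c+e] ⟨
  ℕ→ℚ a ℚ.* N               ≡⟨ ℕ→ℚ-homo-* a n ⟨
  ℕ→ℚ (a * n)               ∎)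
  where
  open ℚₚ.≤-Reasoning
  N = ℕ→ℚ n
  K = ℕ→ℚ k
  K*-mono : ∀ {p r} → p ℚ.≤ r → K ℚ.* p ℚ.≤ K ℚ.* r
  K*-mono = ℚₚ.*-monoˡ-≤-nonNeg K {{ℕ→ℚ-nonNeg k}}
  *N-mono : ∀ {p r} → p ℚ.≤ r → p ℚ.* N ℚ.≤ r ℚ.* N
  *N-mono = ℚₚ.*-monoʳ-≤-nonNeg N {{ℕ→ℚ-nonNeg n}}

∑-mono-≤ : ∀ {n} {f g : Fin n → ℕ} → (∀ i → f i ≤ g i) → ∑ f ≤ ∑ g
∑-mono-≤ {zero}  f≤g = z≤n
∑-mono-≤ {suc n} f≤g = ℕₚ.+-mono-≤ (f≤g zero) (∑-mono-≤ (f≤g ∘ suc))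

∑-mono-< : ∀ {n} {f g : Fin n → ℕ} → (∀ i → f i ≤ g i) → ∀ i → f i < g i → ∑ f < ∑ g
∑-mono-< f≤g zero    fi<gi = ℕₚ.+-mono-<-≤ fi<gi (∑-mono-≤ (f≤g ∘ suc))
∑-mono-< f≤g (suc i) fi<gi = ℕₚ.+-mono-≤-< (f≤g zero) (∑-mono-< (f≤g ∘ suc) i fi<gi)

sum-tabulate : ∀ {n} (f : Fin n → ℕ) → sum (List.tabulate f) ≡ ∑ f
sum-tabulate {zero}  f = refl
sum-tabulate {suc n} f = cong (f zero ℕ.+_) (sum-tabulate (f ∘ suc))

sum-map-allFin : ∀ {n} (f : Fin n → ℕ) → sum (map f (allFin n)) ≡ ∑ f
sum-map-allFin f = trans (cong sum (map-tabulate (λ i → i) f)) (sum-tabulate f)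

sum-map-allFin-0 : ∀ {n} (f : Fin n → ℕ) → (∀ i → f i ≡ 0) → sum (map f (allFin n)) ≡ 0
sum-map-allFin-0 {n} f f≗0 = trans (sum-map-allFin f) (trans (sum-cong-≗ f≗0) (sum-replicate-zero n))

δ : ∀ {n} → Fin n → Fin n → ℕ
δ i j = if does (i ≟ j) then 1 else 0

δ-refl : ∀ {n} (i : Fin n) → δ i i ≡ 1
δ-refl i rewrite dec-true (i ≟ i) refl = refl

δ-≢ : ∀ {n} {i j : Fin n} → i ≢ j → δ i j ≡ 0
δ-≢ {i = i} {j} i≢j rewrite dec-false (i ≟ j) i≢j = refl

δ-sym : ∀ {n} (i j : Fin n) → δ i j ≡ δ j i
δ-sym i j with i ≟ j
... | yes refl = sym (δ-refl i)
... | no i≢j   = sym (δ-≢ (i≢j ∘ sym))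

δ-injective : ∀ {m n} {f : Fin m → Fin n} → Injective _≡_ _≡_ f → ∀ i j → δ (f i) (f j) ≡ δ i j
δ-injective {f = f} f-injective i j with i ≟ j
... | yes refl = δ-refl (f i)
... | no i≢j   = δ-≢ (i≢j ∘ f-injective)

∑-δ : ∀ {n} (i : Fin n) → ∑ (δ i) ≡ 1
∑-δ {suc n} zero    = cong suc (sum-replicate-zero n)
∑-δ {suc n} (suc i) = ∑-δ i

injective⇒surjective : ∀ {n} {f : Fin n → Fin n} → Injective _≡_ _≡_ f → ∀ j → ∃ λ i → f i ≡ j
injective⇒surjective {suc n} {f} f-injective j with any? (λ i → f i ≟ j)
... | yes found = found
... | no ∄i = contradiction (injective⇒≤ punchOut∘f-injective) ℕₚ.1+n≰n
  where
  j≢f : ∀ i → j ≢ f i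
  j≢f i j≡fi = ∄i (i , sym j≡fi)
  punchOut∘f-injective : Injective _≡_ _≡_ (λ i → punchOut (j≢f i))
  punchOut∘f-injective = f-injective ∘ punchOut-injective (j≢f _) (j≢f _)

∣p∪q∣+∣p∩q∣≡∣p∣+∣q∣ : ∀ {n} (p q : Subset n) → ∣ p ∪ q ∣ + ∣ p ∩ q ∣ ≡ ∣ p ∣ + ∣ q ∣
∣p∪q∣+∣p∩q∣≡∣p∣+∣q∣ []            []            = refl
∣p∪q∣+∣p∩q∣≡∣p∣+∣q∣ (outside ∷ p) (outside ∷ q) = ∣p∪q∣+∣p∩q∣≡∣p∣+∣q∣ p q
∣p∪q∣+∣p∩q∣≡∣p∣+∣q∣ (outside ∷ p) (inside ∷ q)  =
  trans (cong suc (∣p∪q∣+∣p∩q∣≡∣p∣+∣q∣ p q)) (sym (ℕₚ.+-suc ∣ p ∣ ∣ q ∣))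
∣p∪q∣+∣p∩q∣≡∣p∣+∣q∣ (inside ∷ p)  (outside ∷ q) = cong suc (∣p∪q∣+∣p∩q∣≡∣p∣+∣q∣ p q)
∣p∪q∣+∣p∩q∣≡∣p∣+∣q∣ (inside ∷ p)  (inside ∷ q)  = cong suc (begin
  ∣ p ∪ q ∣ + suc ∣ p ∩ q ∣    ≡⟨ ℕₚ.+-suc ∣ p ∪ q ∣ ∣ p ∩ q ∣ ⟩
  suc (∣ p ∪ q ∣ + ∣ p ∩ q ∣)  ≡⟨ cong suc (∣p∪q∣+∣p∩q∣≡∣p∣+∣q∣ p q) ⟩
  suc (∣ p ∣ + ∣ q ∣)          ≡⟨ ℕₚ.+-suc ∣ p ∣ ∣ q ∣ ⟨
  ∣ p ∣ + suc ∣ q ∣            ∎)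
  where open ≡-Reasoning

∣p∣≡∣p∩q∣+∣p─q∣ : ∀ {n} (p q : Subset n) → ∣ p ∣ ≡ ∣ p ∩ q ∣ + ∣ p ─ q ∣
∣p∣≡∣p∩q∣+∣p─q∣ []            []            = refl
∣p∣≡∣p∩q∣+∣p─q∣ (outside ∷ p) (outside ∷ q) = ∣p∣≡∣p∩q∣+∣p─q∣ p q
∣p∣≡∣p∩q∣+∣p─q∣ (outside ∷ p) (inside ∷ q)  = ∣p∣≡∣p∩q∣+∣p─q∣ p q
∣p∣≡∣p∩q∣+∣p─q∣ (inside ∷ p)  (outside ∷ q) =
  trans (cong suc (∣p∣≡∣p∩q∣+∣p─q∣ p q)) (sym (ℕₚ.+-suc ∣ p ∩ q ∣ ∣ p ─ q ∣))
∣p∣≡∣p∩q∣+∣p─q∣ (inside ∷ p)  (inside ∷ q)  = cong suc (∣p∣≡∣p∩q∣+∣p─q∣ p q)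

Empty⇒∣p∣≡0 : ∀ {n} {p : Subset n} → Empty p → ∣ p ∣ ≡ 0
Empty⇒∣p∣≡0 {n} p=∅ = trans (cong ∣_∣ (Empty-unique p=∅)) (∣⊥∣≡0 n)

∣p∣>0⇒nonempty : ∀ {n} (p : Subset n) → 0 < ∣ p ∣ → Nonempty p
∣p∣>0⇒nonempty p 0<∣p∣ with nonempty? p
... | yes p≠∅ = p≠∅
... | no p=∅  = contradiction (Empty⇒∣p∣≡0 p=∅) (ℕₚ.>⇒≢ 0<∣p∣)

disjoint-∪⊆⇒∣p∣+∣q∣≤∣r∣ : ∀ {n} {p q r : Subset n} → (∀ {x} → x ∈ p → x ∉ q) → p ∪ q ⊆ r →
  ∣ p ∣ + ∣ q ∣ ≤ ∣ r ∣
disjoint-∪⊆⇒∣p∣+∣q∣≤∣r∣ {p = p} {q} {r} disjoint p∪q⊆r = begin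
  ∣ p ∣ + ∣ q ∣          ≡⟨ ∣p∪q∣+∣p∩q∣≡∣p∣+∣q∣ p q ⟨
  ∣ p ∪ q ∣ + ∣ p ∩ q ∣  ≡⟨ cong (∣ p ∪ q ∣ +_) (Empty⇒∣p∣≡0 p∩q=∅) ⟩
  ∣ p ∪ q ∣ + 0          ≡⟨ ℕₚ.+-identityʳ ∣ p ∪ q ∣ ⟩
  ∣ p ∪ q ∣              ≤⟨ p⊆q⇒∣p∣≤∣q∣ p∪q⊆r ⟩
  ∣ r ∣                  ∎
  where
  open ℕₚ.≤-Reasoning
  p∩q=∅ : Empty (p ∩ q)
  p∩q=∅ (x , x∈p∩q) = disjoint (proj₁ (x∈p∩q⁻ p q x∈p∩q)) (proj₂ (x∈p∩q⁻ p q x∈p∩q))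

x∈p─q⇒x∉q : ∀ {n} {x : Fin n} {p q : Subset n} → x ∈ p ─ q → x ∉ q
x∈p─q⇒x∉q {p = inside ∷ p} {outside ∷ q} here       ()
x∈p─q⇒x∉q {p = _ ∷ p}      {_ ∷ q}       (there x∈) (there x∈q) = x∈p─q⇒x∉q x∈ x∈q

x∈p-y⇒x≢y : ∀ {n} {x y : Fin n} {p : Subset n} → x ∈ p - y → x ≢ y
x∈p-y⇒x≢y {y = y} x∈p-y refl = x∈p─q⇒x∉q x∈p-y (x∈⁅x⁆ y)

∣p∣≤1+∣p-x∣ : ∀ {n} (p : Subset n) (x : Fin n) → ∣ p ∣ ≤ suc ∣ p - x ∣
∣p∣≤1+∣p-x∣ p x = begin
  ∣ p ∣                      ≡⟨ ∣p∣≡∣p∩q∣+∣p─q∣ p ⁅ x ⁆ ⟩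
  ∣ p ∩ ⁅ x ⁆ ∣ + ∣ p - x ∣  ≤⟨ ℕₚ.+-monoˡ-≤ ∣ p - x ∣ (∣p∩q∣≤∣q∣ p ⁅ x ⁆) ⟩
  ∣ ⁅ x ⁆ ∣ + ∣ p - x ∣      ≡⟨ cong (_+ ∣ p - x ∣) (∣⁅x⁆∣≡1 x) ⟩
  suc ∣ p - x ∣              ∎
  where open ℕₚ.≤-Reasoning

∣p∣≤1⇒x≡y : ∀ {n} {p : Subset n} {x y : Fin n} → ∣ p ∣ ≤ 1 → x ∈ p → y ∈ p → x ≡ y
∣p∣≤1⇒x≡y {p = p} {x} {y} ∣p∣≤1 x∈p y∈p with x ≟ y
... | yes x≡y = x≡y
... | no x≢y  = contradiction (ℕₚ.≤-pred (ℕₚ.≤-trans (x∈p⇒∣p-x∣<∣p∣ x∈p) ∣p∣≤1)) (ℕₚ.<⇒≱ 0<∣p-x∣)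
  where
  0<∣p-x∣ : 0 < ∣ p - x ∣
  0<∣p-x∣ = subst (_≤ ∣ p - x ∣) (∣⁅x⁆∣≡1 y) (p⊆q⇒∣p∣≤∣q∣ λ z∈⁅y⁆ →
    subst (_∈ p - x) (sym (x∈⁅y⁆⇒x≡y y z∈⁅y⁆)) (x∈p∧x≢y⇒x∈p-y y∈p (x≢y ∘ sym)))

∣p∣≥2⇒two-elements : ∀ {n} (p : Subset n) → 2 ≤ ∣ p ∣ → ∃ λ x → ∃ λ y → x ∈ p × y ∈ p × x ≢ y
∣p∣≥2⇒two-elements p 2≤∣p∣ with ∣p∣>0⇒nonempty p (ℕₚ.≤-trans (s≤s z≤n) 2≤∣p∣)
... | x , x∈p with ∣p∣>0⇒nonempty (p - x) (ℕₚ.≤-pred (ℕₚ.≤-trans 2≤∣p∣ (∣p∣≤1+∣p-x∣ p x)))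
... | y , y∈p-x = x , y , x∈p , p─q⊆p p ⁅ x ⁆ y∈p-x , x∈p-y⇒x≢y y∈p-x ∘ sym

∣p∣≤length-filter : ∀ {a ℓ} {A : Set a} {P : Pred A ℓ} (P? : Decidable P) {n} (f : Fin n → A)
  (W : Subset n) → (∀ {w} → w ∈ W → P (f w)) → ∣ W ∣ ≤ length (filter P? (List.tabulate f))
∣p∣≤length-filter P? f []      _   = z≤n
∣p∣≤length-filter P? f (s ∷ W) W⊆P with P? (f zero) | ∣p∣≤length-filter P? (f ∘ suc) W (W⊆P ∘ there)
∣p∣≤length-filter P? f (inside ∷ W)  W⊆P | yes _    | ∣W∣≤ = s≤s ∣W∣≤
∣p∣≤length-filter P? f (inside ∷ W)  W⊆P | no ¬Pf0 | _    = contradiction (W⊆P here) ¬Pf0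
∣p∣≤length-filter P? f (outside ∷ W) W⊆P | yes _    | ∣W∣≤ = ℕₚ.m≤n⇒m≤1+n ∣W∣≤
∣p∣≤length-filter P? f (outside ∷ W) W⊆P | no _     | ∣W∣≤ = ∣W∣≤

∉⇒lookup≡false : ∀ {n} {x : Fin n} {p : Subset n} → x ∉ p → lookup p x ≡ false
∉⇒lookup≡false {x = x} {p} x∉p = ¬-not (x∉p ∘ lookup⇒[]= x p)

-- Hall's theorem

N : ∀ {n m} → (Fin n → Subset m) → Subset n → Subset m
N {zero}  R []            = ⊥
N {suc n} R (inside ∷ X)  = R zero ∪ N (R ∘ suc) X
N {suc n} R (outside ∷ X) = N (R ∘ suc) X

y∈N⁺ : ∀ {n m} (R : Fin n → Subset m) {X i y} → i ∈ X → y ∈ R i → y ∈ N R X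
y∈N⁺ R {inside ∷ X}  here        y∈Ri = x∈p∪q⁺ (inj₁ y∈Ri)
y∈N⁺ R {inside ∷ X}  (there i∈X) y∈Ri = x∈p∪q⁺ {p = R zero} (inj₂ (y∈N⁺ (R ∘ suc) i∈X y∈Ri))
y∈N⁺ R {outside ∷ X} (there i∈X) y∈Ri = y∈N⁺ (R ∘ suc) i∈X y∈Ri

y∈N⁻ : ∀ {n m} (R : Fin n → Subset m) {X y} → y ∈ N R X → ∃ λ i → i ∈ X × y ∈ R i
y∈N⁻ R {[]}          y∈N = contradiction y∈N ∉⊥
y∈N⁻ R {inside ∷ X}  y∈N with x∈p∪q⁻ (R zero) (N (R ∘ suc) X) y∈N
... | inj₁ y∈R0 = zero , here , y∈R0
... | inj₂ y∈N′ with i , i∈X , y∈Ri ← y∈N⁻ (R ∘ suc) y∈N′ = suc i , there i∈X , y∈Ri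
y∈N⁻ R {outside ∷ X} y∈N with i , i∈X , y∈Ri ← y∈N⁻ (R ∘ suc) y∈N = suc i , there i∈X , y∈Ri

N-mono : ∀ {n m} (R : Fin n → Subset m) {X Y} → X ⊆ Y → N R X ⊆ N R Y
N-mono R X⊆Y y∈N with i , i∈X , y∈Ri ← y∈N⁻ R y∈N = y∈N⁺ R (X⊆Y i∈X) y∈Ri

N-⁅⁆ : ∀ {n m} (R : Fin n → Subset m) i → N R ⁅ i ⁆ ⊆ R i
N-⁅⁆ R i {y} y∈N with k , k∈⁅i⁆ , y∈Rk ← y∈N⁻ R y∈N = subst (λ k → y ∈ R k) (x∈⁅y⁆⇒x≡y i k∈⁅i⁆) y∈Rk

∣X∣≤∣R∣⇒∣X∣≤∣NX∣ : ∀ {n m} (R : Fin n → Subset m) {X} → (∀ {i} → i ∈ X → ∣ X ∣ ≤ ∣ R i ∣) →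
  ∣ X ∣ ≤ ∣ N R X ∣
∣X∣≤∣R∣⇒∣X∣≤∣NX∣ R {X} ∣X∣≤∣R∣ with nonempty? X
... | yes (i , i∈X) = ℕₚ.≤-trans (∣X∣≤∣R∣ i∈X) (p⊆q⇒∣p∣≤∣q∣ (y∈N⁺ R i∈X))
... | no X=∅        = subst (_≤ ∣ N R X ∣) (sym (Empty⇒∣p∣≡0 X=∅)) z≤n

HallCondition : ∀ {n m} → (Fin n → Subset m) → Set
HallCondition R = ∀ X → ∣ X ∣ ≤ ∣ N R X ∣

hall-or-violator : ∀ {n m} (R : Fin n → Subset m) → HallCondition R ⊎ ∃ λ X → ∣ N R X ∣ < ∣ X ∣
hall-or-violator R with anySubset? (λ X → ∣ N R X ∣ ℕ.<? ∣ X ∣)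
... | yes violator = inj₂ violator
... | no ∄violator = inj₁ λ X → ℕₚ.≮⇒≥ (∄violator ∘ (X ,_))

record Matching {n m} (R : Fin n → Subset m) : Set where
  field
    match           : Fin n → Fin m
    match∈          : ∀ i → match i ∈ R i
    match-injective : Injective _≡_ _≡_ match

Matching-mono : ∀ {n m} {R R′ : Fin n → Subset m} → (∀ i → R i ⊆ R′ i) → Matching R → Matching R′
Matching-mono R⊆R′ M = record
  { match = match ; match∈ = λ i → R⊆R′ i (match∈ i) ; match-injective = match-injective }
  where open Matching M

deleteEdge : ∀ {n m} → (Fin n → Subset m) → Fin n → Fin m → Fin n → Subset m
deleteEdge R i b = updateAt R i (_- b)

edgeCount : ∀ {n m} → (Fin n → Subset m) → ℕ
edgeCount R = ∑ (λ i → ∣ R i ∣)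

module _ {n m} (R : Fin n → Subset m) (i : Fin n) (b : Fin m) where

  deleteEdge-⊆ : ∀ j → deleteEdge R i b j ⊆ R j
  deleteEdge-⊆ j with j ≟ i
  ... | yes refl = subst (_⊆ R i) (sym (updateAt-updates i R)) (p─q⊆p (R i) ⁅ b ⁆)
  ... | no j≢i   = subst (_⊆ R j) (sym (updateAt-minimal j i R j≢i)) (λ y∈ → y∈)

  ∈deleteEdge⁺ : ∀ {j y} → y ∈ R j → (j ≡ i → y ≢ b) → y ∈ deleteEdge R i b j
  ∈deleteEdge⁺ {j} {y} y∈Rj y≢b with j ≟ i
  ... | yes refl = subst (y ∈_) (sym (updateAt-updates i R)) (x∈p∧x≢y⇒x∈p-y y∈Rj (y≢b refl))
  ... | no j≢i   = subst (y ∈_) (sym (updateAt-minimal j i R j≢i)) y∈Rj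

  edgeCount-deleteEdge : b ∈ R i → edgeCount (deleteEdge R i b) < edgeCount R
  edgeCount-deleteEdge b∈Ri = ∑-mono-< (λ j → p⊆q⇒∣p∣≤∣q∣ (deleteEdge-⊆ j)) i
    (subst (λ p → ∣ p ∣ < ∣ R i ∣) (sym (updateAt-updates i R)) (x∈p⇒∣p-x∣<∣p∣ b∈Ri))

N-∪-deleteEdge : ∀ {n m} {R : Fin n → Subset m} {i b₁ b₂ X₁ X₂} → b₁ ≢ b₂ → i ∈ X₁ → i ∈ X₂ →
  N R (X₁ ∪ X₂) ⊆ N (deleteEdge R i b₁) X₁ ∪ N (deleteEdge R i b₂) X₂
N-∪-deleteEdge {R = R} {i} {b₁} {b₂} {X₁} {X₂} b₁≢b₂ i∈X₁ i∈X₂ {y} y∈N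
  with k , k∈X₁∪X₂ , y∈Rk ← y∈N⁻ R y∈N
  with k ≟ i | x∈p∪q⁻ X₁ X₂ k∈X₁∪X₂
... | no k≢i   | inj₁ k∈X₁ = x∈p∪q⁺ (inj₁ (y∈N⁺ _ k∈X₁ (∈deleteEdge⁺ R i b₁ y∈Rk (λ k≡i _ → k≢i k≡i))))
... | no k≢i   | inj₂ k∈X₂ = x∈p∪q⁺ {p = N (deleteEdge R i b₁) X₁}
                               (inj₂ (y∈N⁺ _ k∈X₂ (∈deleteEdge⁺ R i b₂ y∈Rk (λ k≡i _ → k≢i k≡i))))
... | yes refl | _ with y ≟ b₁
...   | no y≢b₁  = x∈p∪q⁺ (inj₁ (y∈N⁺ _ i∈X₁ (∈deleteEdge⁺ R i b₁ y∈Rk (λ _ → y≢b₁))))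
...   | yes refl = x∈p∪q⁺ {p = N (deleteEdge R i b₁) X₁}
                     (inj₂ (y∈N⁺ _ i∈X₂ (∈deleteEdge⁺ R i b₂ y∈Rk (λ _ → b₁≢b₂))))

N-∩-deleteEdge : ∀ {n m} (R : Fin n → Subset m) i b₁ b₂ X₁ X₂ →
  N R ((X₁ ∩ X₂) - i) ⊆ N (deleteEdge R i b₁) X₁ ∩ N (deleteEdge R i b₂) X₂
N-∩-deleteEdge R i b₁ b₂ X₁ X₂ y∈N with k , k∈Z , y∈Rk ← y∈N⁻ R y∈N =
  x∈p∩q⁺ (y∈N⁺ _ k∈X₁ (∈deleteEdge⁺ R i b₁ y∈Rk k≢i) , y∈N⁺ _ k∈X₂ (∈deleteEdge⁺ R i b₂ y∈Rk k≢i))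
  where
  k∈X₁∩X₂ : k ∈ X₁ ∩ X₂
  k∈X₁∩X₂ = p─q⊆p (X₁ ∩ X₂) ⁅ i ⁆ k∈Z
  k∈X₁ : k ∈ X₁
  k∈X₁ = proj₁ (x∈p∩q⁻ X₁ X₂ k∈X₁∩X₂)
  k∈X₂ : k ∈ X₂
  k∈X₂ = proj₂ (x∈p∩q⁻ X₁ X₂ k∈X₁∩X₂)
  k≢i : ∀ {y b} → k ≡ i → y ≢ b
  k≢i k≡i = contradiction k≡i (x∈p-y⇒x≢y k∈Z)

module _ {n m} {R : Fin n → Subset m} (hallR : HallCondition R) where

  deleteEdge-violator-∋ : ∀ {i b X} → ∣ N (deleteEdge R i b) X ∣ < ∣ X ∣ → i ∈ X
  deleteEdge-violator-∋ {i} {b} {X} violation with i ∈? X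
  ... | yes i∈X = i∈X
  ... | no i∉X  = contradiction (ℕₚ.≤-trans (hallR X) (p⊆q⇒∣p∣≤∣q∣ N⊆N′)) (ℕₚ.<⇒≱ violation)
    where
    N⊆N′ : N R X ⊆ N (deleteEdge R i b) X
    N⊆N′ y∈N with k , k∈X , y∈Rk ← y∈N⁻ R y∈N =
      y∈N⁺ _ k∈X (∈deleteEdge⁺ R i b y∈Rk (λ { refl → contradiction k∈X i∉X }))

  -- Rado: violators X₁, X₂ of the two deletions both contain i, and Hall's condition for R on
  -- X₁ ∪ X₂ and (X₁ ∩ X₂) - i gives ∣ X₁ ∣ + ∣ X₂ ∣ ≤ ∣ P ∣ + ∣ Q ∣ + 1, against the violations.
  deleteEdge-hall : ∀ {i b₁ b₂} → b₁ ≢ b₂ →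
    HallCondition (deleteEdge R i b₁) ⊎ HallCondition (deleteEdge R i b₂)
  deleteEdge-hall {i} {b₁} {b₂} b₁≢b₂
    with hall-or-violator (deleteEdge R i b₁) | hall-or-violator (deleteEdge R i b₂)
  ... | inj₁ hall₁ | _         = inj₁ hall₁
  ... | inj₂ _     | inj₁ hall₂ = inj₂ hall₂
  ... | inj₂ (X₁ , violation₁) | inj₂ (X₂ , violation₂) =
    contradiction (ℕₚ.≤-trans 2+P+Q≤X₁+X₂ X₁+X₂≤1+P+Q) (ℕₚ.<-irrefl refl ∘ ℕₚ.≤-pred)
    where
    P = N (deleteEdge R i b₁) X₁
    Q = N (deleteEdge R i b₂) X₂
    2+P+Q≤X₁+X₂ : suc (suc (∣ P ∣ + ∣ Q ∣)) ≤ ∣ X₁ ∣ + ∣ X₂ ∣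
    2+P+Q≤X₁+X₂ =
      subst (_≤ ∣ X₁ ∣ + ∣ X₂ ∣) (cong suc (ℕₚ.+-suc ∣ P ∣ ∣ Q ∣)) (ℕₚ.+-mono-≤ violation₁ violation₂)
    X₁+X₂≤1+P+Q : ∣ X₁ ∣ + ∣ X₂ ∣ ≤ suc (∣ P ∣ + ∣ Q ∣)
    X₁+X₂≤1+P+Q = begin
      ∣ X₁ ∣ + ∣ X₂ ∣                      ≡⟨ ∣p∪q∣+∣p∩q∣≡∣p∣+∣q∣ X₁ X₂ ⟨
      ∣ X₁ ∪ X₂ ∣ + ∣ X₁ ∩ X₂ ∣            ≤⟨ ℕₚ.+-monoʳ-≤ ∣ X₁ ∪ X₂ ∣ (∣p∣≤1+∣p-x∣ (X₁ ∩ X₂) i) ⟩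
      ∣ X₁ ∪ X₂ ∣ + suc ∣ (X₁ ∩ X₂) - i ∣  ≤⟨ ℕₚ.+-mono-≤ (hallR (X₁ ∪ X₂)) (s≤s (hallR ((X₁ ∩ X₂) - i))) ⟩
      ∣ N R (X₁ ∪ X₂) ∣ + suc ∣ N R ((X₁ ∩ X₂) - i) ∣
        ≤⟨ ℕₚ.+-mono-≤ (p⊆q⇒∣p∣≤∣q∣ (N-∪-deleteEdge b₁≢b₂ (deleteEdge-violator-∋ violation₁)
                                                            (deleteEdge-violator-∋ violation₂)))
                        (s≤s (p⊆q⇒∣p∣≤∣q∣ (N-∩-deleteEdge R i b₁ b₂ X₁ X₂))) ⟩
      ∣ P ∪ Q ∣ + suc ∣ P ∩ Q ∣            ≡⟨ ℕₚ.+-suc ∣ P ∪ Q ∣ ∣ P ∩ Q ∣ ⟩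
      suc (∣ P ∪ Q ∣ + ∣ P ∩ Q ∣)          ≡⟨ cong suc (∣p∪q∣+∣p∩q∣≡∣p∣+∣q∣ P Q) ⟩
      suc (∣ P ∣ + ∣ Q ∣)                  ∎
      where open ℕₚ.≤-Reasoning

hall-≤1 : ∀ {n m} {R : Fin n → Subset m} → HallCondition R → (∀ i → ∣ R i ∣ ≤ 1) → Matching R
hall-≤1 {n} {m} {R} hallR ∣R∣≤1 = record { match = match ; match∈ = match∈ ; match-injective = injective }
  where
  nonempty : ∀ i → Nonempty (R i)
  nonempty i = ∣p∣>0⇒nonempty (R i) (begin
    1              ≡⟨ ∣⁅x⁆∣≡1 i ⟨
    ∣ ⁅ i ⁆ ∣      ≤⟨ hallR ⁅ i ⁆ ⟩
    ∣ N R ⁅ i ⁆ ∣  ≤⟨ p⊆q⇒∣p∣≤∣q∣ (N-⁅⁆ R i) ⟩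
    ∣ R i ∣        ∎)
    where open ℕₚ.≤-Reasoning
  match : Fin n → Fin m
  match i = proj₁ (nonempty i)
  match∈ : ∀ i → match i ∈ R i
  match∈ i = proj₂ (nonempty i)
  injective : Injective _≡_ _≡_ match
  injective {i} {j} mi≡mj with i ≟ j
  ... | yes i≡j = i≡j
  ... | no i≢j  = contradiction (ℕₚ.≤-trans 2≤∣X∣ (ℕₚ.≤-trans (hallR X) ∣NX∣≤1)) λ { (s≤s ()) }
    where
    X = ⁅ i ⁆ ∪ ⁅ j ⁆
    2≤∣X∣ : 2 ≤ ∣ X ∣
    2≤∣X∣ = subst₂ (λ a b → a + b ≤ ∣ X ∣) (∣⁅x⁆∣≡1 i) (∣⁅x⁆∣≡1 j) (disjoint-∪⊆⇒∣p∣+∣q∣≤∣r∣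
      (λ x∈⁅i⁆ x∈⁅j⁆ → i≢j (trans (sym (x∈⁅y⁆⇒x≡y i x∈⁅i⁆)) (x∈⁅y⁆⇒x≡y j x∈⁅j⁆))) (λ x∈X → x∈X))
    match-on-X : ∀ {k} → k ∈ X → match k ≡ match i
    match-on-X k∈X with x∈p∪q⁻ ⁅ i ⁆ ⁅ j ⁆ k∈X
    ... | inj₁ k∈⁅i⁆ = cong match (x∈⁅y⁆⇒x≡y i k∈⁅i⁆)
    ... | inj₂ k∈⁅j⁆ = trans (cong match (x∈⁅y⁆⇒x≡y j k∈⁅j⁆)) (sym mi≡mj)
    NX⊆⁅mi⁆ : N R X ⊆ ⁅ match i ⁆
    NX⊆⁅mi⁆ y∈N with k , k∈X , y∈Rk ← y∈N⁻ R y∈N = subst (_∈ ⁅ match i ⁆)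
      (sym (trans (∣p∣≤1⇒x≡y (∣R∣≤1 k) y∈Rk (match∈ k)) (match-on-X k∈X))) (x∈⁅x⁆ (match i))
    ∣NX∣≤1 : ∣ N R X ∣ ≤ 1
    ∣NX∣≤1 = subst (∣ N R X ∣ ≤_) (∣⁅x⁆∣≡1 (match i)) (p⊆q⇒∣p∣≤∣q∣ NX⊆⁅mi⁆)

hall-acc : ∀ {n m} (R : Fin n → Subset m) → Acc _<_ (edgeCount R) → HallCondition R → Matching R
hall-acc R (acc smaller) hallR with any? (λ i → 2 ℕ.≤? ∣ R i ∣)
... | no ∄i = hall-≤1 hallR (λ i → ℕₚ.≤-pred (ℕₚ.≰⇒> (∄i ∘ (i ,_))))
... | yes (i , 2≤∣Ri∣) with b₁ , b₂ , b₁∈Ri , b₂∈Ri , b₁≢b₂ ← ∣p∣≥2⇒two-elements (R i) 2≤∣Ri∣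
  with deleteEdge-hall hallR b₁≢b₂
... | inj₁ hall₁ = Matching-mono (deleteEdge-⊆ R i b₁)
  (hall-acc _ (smaller (edgeCount-deleteEdge R i b₁ b₁∈Ri)) hall₁)
... | inj₂ hall₂ = Matching-mono (deleteEdge-⊆ R i b₂)
  (hall-acc _ (smaller (edgeCount-deleteEdge R i b₂ b₂∈Ri)) hall₂)

hall : ∀ {n m} {R : Fin n → Subset m} → HallCondition R → Matching R
hall {R = R} = hall-acc R (<-wellFounded (edgeCount R))

-- The summand of edgesIn is local to its where block; edgesIn-summand names it by unification.
private
  edgesIn-summand : ∀ {n} (H : Graph n) (S : Subset n) →
    Σ (Fin n → Fin n → ℕ) λ c → edgesIn H S ≡ sum (map (λ u → sum (map (c u) (allFin n))) (allFin n))
  edgesIn-summand H S = _ , refl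

edgesIn≡0 : ∀ {n} (H : Graph n) (S : Subset n) →
  (∀ u v → (u ∈ᵇ S) ∧ (v ∈ᵇ S) ∧ adj H u v ≡ false) → edgesIn H S ≡ 0
edgesIn≡0 H S no-edge = trans (proj₂ (edgesIn-summand H S))
  (sum-map-allFin-0 _ λ u → sum-map-allFin-0 _ λ v → summand≡0 u v)
  where
  summand≡0 : ∀ u v → proj₁ (edgesIn-summand H S) u v ≡ 0
  summand≡0 u v rewrite no-edge u v | ∧-zeroʳ ⌊ u <? v ⌋ = refl

module _ {n} (H : Graph n) where

  nbhd : Fin n → Subset n
  nbhd u = tabulate (adj H u)

  ∈nbhd⇒adj : ∀ {u v} → v ∈ nbhd u → adj H u v ≡ true
  ∈nbhd⇒adj {u} {v} v∈ = trans (sym (lookup∘tabulate (adj H u) v)) ([]=⇒lookup v∈)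

  adj⇒∈nbhd : ∀ {u v} → adj H u v ≡ true → v ∈ nbhd u
  adj⇒∈nbhd {u} {v} uv = lookup⇒[]= v (nbhd u) (trans (lookup∘tabulate (adj H u) v) uv)

  ∈nbhd-sym : ∀ {u v} → v ∈ nbhd u → u ∈ nbhd v
  ∈nbhd-sym {u} {v} v∈ = adj⇒∈nbhd (trans (Graph.sym H v u) (∈nbhd⇒adj v∈))

  matching⇒perfectTwoMatching : Matching nbhd → PerfectTwoMatching H
  matching⇒perfectTwoMatching M = record { ω = ω ; ω-sym = ω-sym ; ω-edges = ω-edges ; ω-deg = ω-deg }
    where
    open Matching M renaming (match to π; match∈ to π∈nbhd; match-injective to π-injective)
    ω : Fin n → Fin n → ℕ
    ω u v = δ (π u) v + δ u (π v)
    ω-sym : ∀ u v → ω u v ≡ ω v u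
    ω-sym u v = trans (cong₂ _+_ (δ-sym (π u) v) (δ-sym u (π v))) (ℕₚ.+-comm (δ v (π u)) (δ (π v) u))
    ω-edges : ∀ u v → adj H u v ≡ false → ω u v ≡ 0
    ω-edges u v ¬uv = cong₂ _+_ (δ-≢ πu≢v) (δ-≢ u≢πv)
      where
      πu≢v : π u ≢ v
      πu≢v refl = contradiction (trans (sym (∈nbhd⇒adj (π∈nbhd u))) ¬uv) λ ()
      u≢πv : u ≢ π v
      u≢πv refl = contradiction (trans (sym (∈nbhd⇒adj (∈nbhd-sym (π∈nbhd v)))) ¬uv) λ ()
    ω-deg : ∀ v → sum (map (ω v) (allFin n)) ≡ 2
    ω-deg v with w , πw≡v ← injective⇒surjective π-injective v = begin
      sum (map (ω v) (allFin n))              ≡⟨ sum-map-allFin (ω v) ⟩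
      ∑ (ω v)                                 ≡⟨ ∑-distrib-+ (δ (π v)) (λ u → δ v (π u)) ⟩
      ∑ (δ (π v)) + ∑ (λ u → δ v (π u))       ≡⟨ cong (λ x → ∑ (δ (π v)) + ∑ (λ u → δ x (π u))) πw≡v ⟨
      ∑ (δ (π v)) + ∑ (λ u → δ (π w) (π u))
        ≡⟨ cong (∑ (δ (π v)) +_) (sum-cong-≗ (δ-injective π-injective w)) ⟩
      ∑ (δ (π v)) + ∑ (δ w)                   ≡⟨ cong₂ _+_ (∑-δ (π v)) (∑-δ w) ⟩
      2                                       ∎
      where open ≡-Reasoning

  Independent : Subset n → Set
  Independent I = ∀ {u v} → u ∈ I → v ∈ I → v ∉ nbhd u

  edgesIn-independent : ∀ {I} → Independent I → edgesIn H I ≡ 0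
  edgesIn-independent {I} independent = edgesIn≡0 H I no-edge
    where
    no-edge : ∀ u v → (u ∈ᵇ I) ∧ (v ∈ᵇ I) ∧ adj H u v ≡ false
    no-edge u v with u ∈ᵇ I in u∈I | v ∈ᵇ I in v∈I
    ... | false | _     = refl
    ... | true  | false = refl
    ... | true  | true  = ¬-not λ uv → independent (lookup⇒[]= u I u∈I) (lookup⇒[]= v I v∈I) (adj⇒∈nbhd uv)

  independent-expansion⇒hall : (∀ I → Independent I → ∣ I ∣ ≤ ∣ N nbhd I ∣) → HallCondition nbhd
  independent-expansion⇒hall expands X = begin
    ∣ X ∣                     ≡⟨ ∣p∣≡∣p∩q∣+∣p─q∣ X NX ⟩
    ∣ X ∩ NX ∣ + ∣ I ∣        ≤⟨ ℕₚ.+-monoʳ-≤ ∣ X ∩ NX ∣ (expands I I-independent) ⟩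
    ∣ X ∩ NX ∣ + ∣ N nbhd I ∣ ≤⟨ disjoint-∪⊆⇒∣p∣+∣q∣≤∣r∣ disjoint ∪⊆NX ⟩
    ∣ NX ∣                    ∎
    where
    open ℕₚ.≤-Reasoning
    NX = N nbhd X
    I = X ─ NX
    I-independent : Independent I
    I-independent u∈I v∈I v∈Nu = x∈p─q⇒x∉q v∈I (y∈N⁺ nbhd (p─q⊆p X NX u∈I) v∈Nu)
    disjoint : ∀ {y} → y ∈ X ∩ NX → y ∉ N nbhd I
    disjoint y∈X∩NX y∈NI with k , k∈I , y∈Nk ← y∈N⁻ nbhd y∈NI =
      x∈p─q⇒x∉q k∈I (y∈N⁺ nbhd (proj₁ (x∈p∩q⁻ X NX y∈X∩NX)) (∈nbhd-sym y∈Nk))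
    ∪⊆NX : (X ∩ NX) ∪ N nbhd I ⊆ NX
    ∪⊆NX y∈ with x∈p∪q⁻ (X ∩ NX) (N nbhd I) y∈
    ... | inj₁ y∈X∩NX = proj₂ (x∈p∩q⁻ X NX y∈X∩NX)
    ... | inj₂ y∈NI   = N-mono nbhd (p─q⊆p X NX) y∈NI

  module _ (A : Subset n) (bipartite : BipartiteWith H A) where

    nbhd-A⊆∁A : ∀ {u} → u ∈ A → nbhd u ⊆ ∁ A
    nbhd-A⊆∁A {u} u∈A {v} v∈Nu = x∉p⇒x∈∁p λ v∈A →
      bipartite u v (∈nbhd⇒adj v∈Nu) (trans ([]=⇒lookup u∈A) (sym ([]=⇒lookup v∈A)))

    nbhd-∁A⊆A : ∀ {u} → u ∈ ∁ A → nbhd u ⊆ A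
    nbhd-∁A⊆A {u} u∈∁A {v} v∈Nu with v ∈? A
    ... | yes v∈A = v∈A
    ... | no v∉A  = contradiction (trans (∉⇒lookup≡false (x∈∁p⇒x∉p u∈∁A)) (sym (∉⇒lookup≡false v∉A)))
                                  (bipartite u v (∈nbhd⇒adj v∈Nu))

    bipartite⇒hall : (∀ X → X ⊆ A → ∣ X ∣ ≤ ∣ N nbhd X ∣) → (∀ X → X ⊆ ∁ A → ∣ X ∣ ≤ ∣ N nbhd X ∣) →
      HallCondition nbhd
    bipartite⇒hall hallA hall∁A X = begin
      ∣ X ∣                                ≡⟨ ∣p∣≡∣p∩q∣+∣p─q∣ X A ⟩
      ∣ X ∩ A ∣ + ∣ X ─ A ∣
        ≤⟨ ℕₚ.+-mono-≤ (hallA (X ∩ A) (p∩q⊆q X A)) (hall∁A (X ─ A) X─A⊆∁A) ⟩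
      ∣ N nbhd (X ∩ A) ∣ + ∣ N nbhd (X ─ A) ∣
        ≤⟨ disjoint-∪⊆⇒∣p∣+∣q∣≤∣r∣ disjoint ∪⊆NX ⟩
      ∣ N nbhd X ∣                         ∎
      where
      open ℕₚ.≤-Reasoning
      X─A⊆∁A : X ─ A ⊆ ∁ A
      X─A⊆∁A = x∉p⇒x∈∁p ∘ x∈p─q⇒x∉q
      disjoint : ∀ {y} → y ∈ N nbhd (X ∩ A) → y ∉ N nbhd (X ─ A)
      disjoint y∈N₁ y∈N₂ with k₁ , k₁∈ , y∈Nk₁ ← y∈N⁻ nbhd y∈N₁ | k₂ , k₂∈ , y∈Nk₂ ← y∈N⁻ nbhd y∈N₂ =
        x∈∁p⇒x∉p (nbhd-A⊆∁A (p∩q⊆q X A k₁∈) y∈Nk₁) (nbhd-∁A⊆A (X─A⊆∁A k₂∈) y∈Nk₂)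
      ∪⊆NX : N nbhd (X ∩ A) ∪ N nbhd (X ─ A) ⊆ N nbhd X
      ∪⊆NX y∈ with x∈p∪q⁻ (N nbhd (X ∩ A)) (N nbhd (X ─ A)) y∈
      ... | inj₁ y∈N₁ = N-mono nbhd (p∩q⊆p X A) y∈N₁
      ... | inj₂ y∈N₂ = N-mono nbhd (p─q⊆p X A) y∈N₂

  robustType1⇒independent-small : ∀ {μ ν I} → 0ℚ ℚ.< ν → RobustType1 μ ν H → Independent I → Fin n →
    ℕ→ℚ ∣ I ∣ ℚ.< (ℤ.+ 1 / 2 ℚ.- ν) ℚ.* ℕ→ℚ n
  robustType1⇒independent-small {μ} {ν} {I} 0<ν (_ , dense) independent v = ℚₚ.≰⇒> λ large →
    ℚₚ.<-irrefl refl (ℚₚ.<-≤-trans 0<νn²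
      (subst (λ e → ν ℚ.* ℕ→ℚ (n * n) ℚ.≤ ℕ→ℚ e) (edgesIn-independent independent) (dense I large)))
    where
    0<n : 0 < n
    0<n = ℕₚ.≤-<-trans z≤n (toℕ<n v)
    0<νn² : 0ℚ ℚ.< ν ℚ.* ℕ→ℚ (n * n)
    0<νn² = *-ℕ→ℚ-pos 0<ν (ℕₚ.*-mono-< 0<n 0<n)

  robustType1⇒hall : ∀ {μ ν} → 0ℚ ℚ.< μ → μ ℚ.≤ ν → RobustType1 μ ν H → HallCondition nbhd
  robustType1⇒hall {μ} {ν} 0<μ μ≤ν type1@(minDeg , _) = independent-expansion⇒hall λ I independent →
    ∣X∣≤∣R∣⇒∣X∣≤∣NX∣ nbhd λ {v} _ → ℕₚ.<⇒≤ (ℕ→ℚ-cancel-< (ℚₚ.<-≤-trans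
      (robustType1⇒independent-small {μ} (ℚₚ.<-≤-trans 0<μ μ≤ν) type1 independent v)
      (ℚₚ.≤-trans half-ν≤half-μ (minDeg v))))
    where
    half-ν≤half-μ : (ℤ.+ 1 / 2 ℚ.- ν) ℚ.* ℕ→ℚ n ℚ.≤ (ℤ.+ 1 / 2 ℚ.- μ) ℚ.* ℕ→ℚ n
    half-ν≤half-μ = ℚₚ.*-monoʳ-≤-nonNeg (ℕ→ℚ n) {{ℕ→ℚ-nonNeg n}}
      (ℚₚ.+-monoʳ-≤ (ℤ.+ 1 / 2) (ℚₚ.neg-antimono-≤ μ≤ν))

  -- The integral stand-in for the paper's threshold (1/3 - μ) n, valid for μ ≤ 1/300.
  LowDegree : Fin n → Set
  LowDegree u = 100 * deg H u < 33 * n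

  module DegreeBounds (L : ℕ) (low-count : ∀ W → (∀ {w} → w ∈ W → LowDegree w) → ∣ W ∣ ≤ L)
           (minDeg : ∀ u → n ≤ 40 * deg H u) (few-low : 50 * L ≤ n) where

    ∃¬LowDegree : ∀ U → 0 < ∣ U ∣ → (∀ {u} → u ∈ U → deg H u < ∣ U ∣) → ∃ λ u → u ∈ U × ¬ LowDegree u
    ∃¬LowDegree U 0<∣U∣ deg<∣U∣ with any? (λ u → (u ∈? U) ×-dec ¬? (100 * deg H u ℕ.<? 33 * n))
    ... | yes high = high
    ... | no ∄high with u , u∈U ← ∣p∣>0⇒nonempty U 0<∣U∣ = contradiction n<n (ℕₚ.<-irrefl refl)
      where
      all-low : ∀ {w} → w ∈ U → LowDegree w
      all-low {w} w∈U = decidable-stable (100 * deg H w ℕ.<? 33 * n) (λ ¬low → ∄high (w , w∈U , ¬low))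
      n<n : n < n
      n<n = begin-strict
        n             ≤⟨ minDeg u ⟩
        40 * deg H u  <⟨ ℕₚ.*-monoʳ-< 40 (deg<∣U∣ u∈U) ⟩
        40 * ∣ U ∣    ≤⟨ ℕₚ.*-monoʳ-≤ 40 (low-count U all-low) ⟩
        40 * L        ≤⟨ ℕₚ.*-monoˡ-≤ L (ℕₚ.m≤m+n 40 10) ⟩
        50 * L        ≤⟨ few-low ⟩
        n             ∎
        where open ℕₚ.≤-Reasoning

    hall-on-side : ∀ {S T} → ∣ S ∣ + ∣ S ∣ ≡ n → ∣ T ∣ ≡ ∣ S ∣ → (∀ {u} → u ∈ T → nbhd u ⊆ S) →
      ∀ X → X ⊆ S → ∣ X ∣ ≤ ∣ N nbhd X ∣
    hall-on-side {S} {T} 2∣S∣≡n ∣T∣≡∣S∣ nbhd-T⊆S X X⊆S = ℕₚ.≮⇒≥ λ NX<X →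
      ℕₚ.<⇒≱ (17n<100∣X∣ NX<X (∃¬LowDegree X (ℕₚ.≤-<-trans z≤n NX<X) (deg-X<X NX<X)))
             (100∣X∣≤17n (∃¬LowDegree W (ℕₚ.≤-<-trans z≤n (S′<W NX<X)) (deg-W<W NX<X)))
      where
      NX = N nbhd X
      W = T ─ NX
      S′ = S ─ X
      S′+X≤S : ∣ S′ ∣ + ∣ X ∣ ≤ ∣ S ∣
      S′+X≤S = disjoint-∪⊆⇒∣p∣+∣q∣≤∣r∣ x∈p─q⇒x∉q S′∪X⊆S
        where
        S′∪X⊆S : S′ ∪ X ⊆ S
        S′∪X⊆S y∈ with x∈p∪q⁻ S′ X y∈
        ... | inj₁ y∈S′ = p─q⊆p S X y∈S′
        ... | inj₂ y∈X  = X⊆S y∈X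
      S≤NX+W : ∣ S ∣ ≤ ∣ NX ∣ + ∣ W ∣
      S≤NX+W = begin
        ∣ S ∣               ≡⟨ ∣T∣≡∣S∣ ⟨
        ∣ T ∣               ≡⟨ ∣p∣≡∣p∩q∣+∣p─q∣ T NX ⟩
        ∣ T ∩ NX ∣ + ∣ W ∣  ≤⟨ ℕₚ.+-monoˡ-≤ ∣ W ∣ (∣p∩q∣≤∣q∣ T NX) ⟩
        ∣ NX ∣ + ∣ W ∣      ∎
        where open ℕₚ.≤-Reasoning
      S′<W : ∣ NX ∣ < ∣ X ∣ → ∣ S′ ∣ < ∣ W ∣
      S′<W NX<X = ℕₚ.+-cancelˡ-< (∣ NX ∣) (∣ S′ ∣) (∣ W ∣) (begin-strict
        ∣ NX ∣ + ∣ S′ ∣  <⟨ ℕₚ.+-monoˡ-< ∣ S′ ∣ NX<X ⟩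
        ∣ X ∣ + ∣ S′ ∣   ≡⟨ ℕₚ.+-comm ∣ X ∣ ∣ S′ ∣ ⟩
        ∣ S′ ∣ + ∣ X ∣   ≤⟨ S′+X≤S ⟩
        ∣ S ∣            ≤⟨ S≤NX+W ⟩
        ∣ NX ∣ + ∣ W ∣   ∎)
        where open ℕₚ.≤-Reasoning
      deg-W≤S′ : ∀ {w} → w ∈ W → deg H w ≤ ∣ S′ ∣
      deg-W≤S′ w∈W = p⊆q⇒∣p∣≤∣q∣ λ y∈Nw → x∈p∧x∉q⇒x∈p─q (nbhd-T⊆S (p─q⊆p T NX w∈W) y∈Nw)
        (λ y∈X → x∈p─q⇒x∉q w∈W (y∈N⁺ nbhd y∈X (∈nbhd-sym y∈Nw)))
      deg-W<W : ∣ NX ∣ < ∣ X ∣ → ∀ {w} → w ∈ W → deg H w < ∣ W ∣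
      deg-W<W NX<X w∈W = ℕₚ.≤-<-trans (deg-W≤S′ w∈W) (S′<W NX<X)
      deg-X<X : ∣ NX ∣ < ∣ X ∣ → ∀ {v} → v ∈ X → deg H v < ∣ X ∣
      deg-X<X NX<X v∈X = ℕₚ.≤-<-trans (p⊆q⇒∣p∣≤∣q∣ (y∈N⁺ nbhd v∈X)) NX<X
      100∣X∣≤17n : (∃ λ w → w ∈ W × ¬ LowDegree w) → 100 * ∣ X ∣ ≤ 17 * n
      100∣X∣≤17n (w , w∈W , w-high) = ℕₚ.+-cancelˡ-≤ (33 * n) (100 * ∣ X ∣) (17 * n) (begin
        33 * n + 100 * ∣ X ∣        ≤⟨ ℕₚ.+-monoˡ-≤ (100 * ∣ X ∣) 33n≤100∣S′∣ ⟩
        100 * ∣ S′ ∣ + 100 * ∣ X ∣  ≡⟨ ℕₚ.*-distribˡ-+ 100 (∣ S′ ∣) (∣ X ∣) ⟨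
        100 * (∣ S′ ∣ + ∣ X ∣)      ≤⟨ ℕₚ.*-monoʳ-≤ 100 S′+X≤S ⟩
        100 * ∣ S ∣                 ≡⟨ ℕₚ.*-distribʳ-+ ∣ S ∣ 50 50 ⟩
        50 * ∣ S ∣ + 50 * ∣ S ∣     ≡⟨ ℕₚ.*-distribˡ-+ 50 (∣ S ∣) (∣ S ∣) ⟨
        50 * (∣ S ∣ + ∣ S ∣)        ≡⟨ cong (50 *_) 2∣S∣≡n ⟩
        50 * n                      ≡⟨ ℕₚ.*-distribʳ-+ n 33 17 ⟩
        33 * n + 17 * n             ∎)
        where
        open ℕₚ.≤-Reasoning
        33n≤100∣S′∣ : 33 * n ≤ 100 * ∣ S′ ∣
        33n≤100∣S′∣ = ℕₚ.≤-trans (ℕₚ.≮⇒≥ w-high) (ℕₚ.*-monoʳ-≤ 100 (deg-W≤S′ w∈W))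
      17n<100∣X∣ : ∣ NX ∣ < ∣ X ∣ → (∃ λ v → v ∈ X × ¬ LowDegree v) → 17 * n < 100 * ∣ X ∣
      17n<100∣X∣ NX<X (v , v∈X , v-high) = begin-strict
        17 * n         ≤⟨ ℕₚ.*-monoˡ-≤ n (ℕₚ.m≤m+n 17 16) ⟩
        33 * n         ≤⟨ ℕₚ.≮⇒≥ v-high ⟩
        100 * deg H v  <⟨ ℕₚ.*-monoʳ-< 100 (deg-X<X NX<X v∈X) ⟩
        100 * ∣ X ∣    ∎
        where open ℕₚ.≤-Reasoning

robustType2⇒hall : ∀ {n μ ν} (H : Graph n) → μ ℚ.≤ ℤ.+ 1 / 1000 → RobustType2 μ ν H →
  HallCondition (nbhd H)
robustType2⇒hall {n} {μ} H μ≤1/1000 (A , 2∣A∣≡n , bipartite , minDeg , fewLow) =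
  bipartite⇒hall H A bipartite (hall-on-side 2∣A∣≡n′ ∣∁A∣≡∣A∣ (nbhd-∁A⊆A H A bipartite))
                               (hall-on-side 2∣∁A∣≡n (sym ∣∁A∣≡∣A∣) (nbhd-A⊆∁A H A bipartite))
  where
  μ≤ : ∀ c → True (ℤ.+ 1 / 1000 ℚ.≤? c) → μ ℚ.≤ c
  μ≤ c 1/1000≤c = ℚₚ.≤-trans μ≤1/1000 (toWitness 1/1000≤c)
  q = (ℤ.+ 1 / 3 ℚ.- μ) ℚ.* ℕ→ℚ n
  L = numLowDeg H q
  low⇒below-q : ∀ {u} → LowDegree H u → ℕ→ℚ (deg H u) ℚ.< q
  low⇒below-q {u} low = ℚₚ.≰⇒> λ q≤deg →
    ℕₚ.<⇒≱ low (lower-bound-ℕ (ℤ.+ 1 / 3) (ℤ.+ 1 / 300) μ 33 100 n (deg H u) (μ≤ _ _) refl q≤deg)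
  low-count : ∀ W → (∀ {w} → w ∈ W → LowDegree H w) → ∣ W ∣ ≤ L
  low-count W all-low = ∣p∣≤length-filter (λ u → ℕ→ℚ (deg H u) ℚ.<? q) (λ u → u) W (low⇒below-q ∘ all-low)
  minDeg′ : ∀ u → n ≤ 40 * deg H u
  minDeg′ u = subst (_≤ 40 * deg H u) (ℕₚ.*-identityˡ n)
    (lower-bound-ℕ (ℤ.+ 1 / 32) (ℤ.+ 1 / 160) μ 1 40 n (deg H u) (μ≤ _ _) refl (minDeg u))
  few-low : 50 * L ≤ n
  few-low = subst (50 * L ≤_) (ℕₚ.*-identityˡ n)
    (upper-bound-ℕ (ℤ.+ 1 / 64) (ℤ.+ 7 / 1600) μ 1 50 n L (μ≤ _ _) refl fewLow)
  open DegreeBounds H L low-count minDeg′ few-low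
  2∣A∣≡n′ : ∣ A ∣ + ∣ A ∣ ≡ n
  2∣A∣≡n′ = trans (cong (∣ A ∣ +_) (sym (ℕₚ.+-identityʳ ∣ A ∣))) 2∣A∣≡n
  ∣∁A∣≡∣A∣ : ∣ ∁ A ∣ ≡ ∣ A ∣
  ∣∁A∣≡∣A∣ = trans (∣∁p∣≡n∸∣p∣ A) (subst (λ k → k ∸ ∣ A ∣ ≡ ∣ A ∣) 2∣A∣≡n′ (ℕₚ.m+n∸m≡n ∣ A ∣ ∣ A ∣))
  2∣∁A∣≡n : ∣ ∁ A ∣ + ∣ ∁ A ∣ ≡ n
  2∣∁A∣≡n = subst (λ k → k + k ≡ n) (sym ∣∁A∣≡∣A∣) 2∣A∣≡n′

robustlyTwoMatchable⇒hall : ∀ {n μ ν} (H : Graph n) → 0ℚ ℚ.< μ → μ ℚ.≤ ν → ν ℚ.< ℤ.+ 1 / 1000 →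
  RobustlyTwoMatchable μ ν H → HallCondition (nbhd H)
robustlyTwoMatchable⇒hall H 0<μ μ≤ν ν<1/1000 (inj₁ type1) = robustType1⇒hall H 0<μ μ≤ν type1
robustlyTwoMatchable⇒hall {μ = μ} {ν} H 0<μ μ≤ν ν<1/1000 (inj₂ type2) =
  robustType2⇒hall {μ = μ} {ν} H (ℚₚ.<⇒≤ (ℚₚ.≤-<-trans μ≤ν ν<1/1000)) type2

lemma3p8 : (μ ν : ℚ) → ℤ.+ 0 / 1 ℚ.< μ → μ ℚ.≤ ν → ν ℚ.< ℤ.+ 1 / 1000 →
    (n : ℕ) (H : Graph n) → RobustlyTwoMatchable μ ν H → PerfectTwoMatching H
lemma3p8 μ ν 0<μ μ≤ν ν<1/1000 n H robust =
  matching⇒perfectTwoMatching H (hall (robustlyTwoMatchable⇒hall H 0<μ μ≤ν ν<1/1000 robust))
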